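{- Let $G$ be an abelian group and $A\subseteq G$ a union of $k$ unbounded linear sets ($k\in\mathbb N$). Then for every $r\in\mathbb N$, $A$ is an asymptotic $\left(r,\binom{(r+1)(k-1)}{k-1}\right)$-approximate group.
   Context: $\mathbb N=\{1,2,\dots\}$, $\mathbb N_0=\{0,1,2,\dots\}$. An unbounded linear set is a set $P(a;b_1,\dots,b_d)=\{a+n_1b_1+\cdots+n_db_d:n_1,\dots,n_d\in\mathbb N_0\}$ with $a,b_j\in G$. For subsets $X,Y$, $X+Y=\{x+y:x\in X,y\in Y\}$; for $h\in\mathbb N$, $hA$ is the $h$-fold sumset and $0A=\{0\}$. A nonempty $A\subseteq G$ is an asymptotic $(r,\ell)$-approximate group if there is $h_0\in\mathbb N$ such that for every integer $h\ge h_0$ there is $X_h\subseteq G$ with $|X_h|\le\ell$ and $r(hA)\subseteq X_h+hA$. -}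

module Defs where

open import Level using (Level; _⊔_)
open import Algebra.Bundles using (AbelianGroup)
open import Data.Nat using (ℕ; zero; suc; _≤_)
open import Data.Fin using (Fin; zero; suc)
open import Data.List using (List; length)
open import Data.List.Relation.Unary.Any using (Any)
open import Data.Product using (Σ; ∃; _×_)

module _ {c ℓ : Level} (G : AbelianGroup c ℓ) where
  open AbelianGroup G

  _•_ : ℕ → Carrier → Carrier
  zero  • x = ε
  suc n • x = x ∙ (n • x)

  sumFin : (d : ℕ) → (Fin d → Carrier) → Carrier
  sumFin zero    f = ε
  sumFin (suc d) f = f zero ∙ sumFin d (λ j → f (suc j))

  record LinearSet : Set c where
    field
      dim     : ℕ
      base    : Carrier
      periods : Fin dim → Carrier

  InLinear : LinearSet → Carrier → Set ℓ
  InLinear P x = ∃ λ (n : Fin (LinearSet.dim P) → ℕ) →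
    x ≈ (LinearSet.base P ∙ sumFin (LinearSet.dim P) (λ j → n j • LinearSet.periods P j))

  UnionOf : {k : ℕ} → (Fin k → LinearSet) → Carrier → Set ℓ
  UnionOf {k} L x = ∃ λ (i : Fin k) → InLinear (L i) x

  SumSet : ∀ {p q} → (Carrier → Set p) → (Carrier → Set q) → Carrier → Set (c ⊔ ℓ ⊔ p ⊔ q)
  SumSet X Y x = ∃ λ y → ∃ λ z → X y × Y z × (x ≈ (y ∙ z))

  FoldSum : ∀ {p} → ℕ → (Carrier → Set p) → Carrier → Set (c ⊔ ℓ ⊔ p)
  FoldSum {p} zero    A x = Level.Lift (c Level.⊔ p) (x ≈ ε)
  FoldSum (suc h) A x = SumSet A (FoldSum h A) x

  -- finite set given by a list (its cardinality is ≤ the list length)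
  ListSet : List Carrier → Carrier → Set (c ⊔ ℓ)
  ListSet X x = Level.Lift c (Any (λ y → x ≈ y) X)

  IsAsymptoticApproxGroup : ∀ {p} → ℕ → ℕ → (Carrier → Set p) → Set (c ⊔ ℓ ⊔ p)
  IsAsymptoticApproxGroup r l A =
    (∃ λ a → A a) ×
    (∃ λ (h₀ : ℕ) → 1 ≤ h₀ × ((h : ℕ) → h₀ ≤ h →
       ∃ λ (X : List Carrier) → length X ≤ l ×
         ((x : Carrier) → FoldSum r (FoldSum h A) x → SumSet (ListSet X) (FoldSum h A) x)))

-- Write x ∈ r(hA) as Σᵢ wᵢ with wᵢ ∈ nᵢPᵢ and Σᵢ nᵢ = rh, where Pᵢ = aᵢ + ⟨periods⟩.
-- Since Pᵢ + Pᵢ = aᵢ + Pᵢ, for any dᵢ ≤ nᵢ - 1 (so dᵢ = 0 when nᵢ = 0) the first dᵢ + 1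
-- summands of wᵢ merge into dᵢaᵢ plus a single element of Pᵢ, hence
-- x ∈ Σᵢ dᵢaᵢ + (rh - Σᵢ dᵢ)A.  It remains to find, for each large h, a family of at
-- most C((r+1)(k-1), k-1) vectors d with Σ d = (r-1)h such that every n with
-- Σ n = rh lies above one of them in this sense.  With g = ⌊(h-1)/(k-1)⌋, let d pour
-- (r-1)h greedily into capacities g·e₁, …, g·e_{k-1}, the last coordinate taking the
-- rest; choosing eᵢ greedily from n works, and then Σ e ≤ r(k-1).

module Submission where

open import Level using (Level; lift)
open import Algebra.Bundles using (AbelianGroup)
open import Data.Nat using (ℕ; zero; suc; _≤_; _<_; _>_; _*_; _+_; _∸_; _⊓_; pred; z≤n; s≤s; s≤s⁻¹; NonZero; >-nonZero)
open import Data.Nat.Properties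
open import Data.Nat.DivMod using (_/_; _%_; m≡m%n+[m/n]*n; m%n<n; m/n*n≤m; m≥n⇒m/n>0)
open import Data.Nat.Combinatorics using (_C_; nCn≡1; nCk+nC[k+1]≡[n+1]C[k+1])
open import Data.Fin using (Fin; zero; suc)
open import Data.Fin.Properties using (∃-toSum; ∃-here; ∃-there; ∀-cons)
open import Data.Vec using (Vec; []; _∷_; sum; map; replicate; zipWith; lookup)
open import Data.Vec.Properties using (lookup-zipWith)
open import Data.Vec.Relation.Binary.Pointwise.Inductive as Pointwise using (Pointwise; []; _∷_)
open import Data.List as List using (List; [_]; _++_; length)
open import Data.List.Properties using (length-map; length-++)
open import Data.List.Membership.Propositional using (_∈_)
open import Data.List.Membership.Propositional.Properties using (∈-map⁺; ∈-++⁺ˡ; ∈-++⁺ʳ)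
open import Data.List.Relation.Unary.Any as Any using (here)
open import Data.Product using (∃; ∃₂; _×_; _,_; proj₁; proj₂)
open import Data.Sum using (_⊎_; inj₁; inj₂)
open import Relation.Binary.PropositionalEquality using (_≡_; refl; sym; trans; cong; cong₂; subst; subst₂; module ≡-Reasoning)
open import Relation.Nullary using (yes; no)
open import Algebra.Properties.CommutativeSemigroup +-commutativeSemigroup using (interchange)
open import Defs

infix 4 _⊴_
_⊴_ : ∀ {k} → Vec ℕ k → Vec ℕ k → Set
_⊴_ = Pointwise (λ d n → d ≤ pred n)

fill : ∀ {K} → ℕ → Vec ℕ K → Vec ℕ (suc K)
fill s []       = s ∷ []
fill s (c ∷ cs) = c ⊓ s ∷ fill (s ∸ c) cs

sum-fill : ∀ {K} s (cs : Vec ℕ K) → sum (fill s cs) ≡ s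
sum-fill s []       = +-identityʳ s
sum-fill s (c ∷ cs) = trans (cong (c ⊓ s +_) (sum-fill (s ∸ c) cs)) (m⊓n+n∸m≡n c s)

fill-0-⊴ : ∀ {K} (cs : Vec ℕ K) n → fill 0 cs ⊴ n
fill-0-⊴ []       (_ ∷ []) = z≤n ∷ []
fill-0-⊴ (c ∷ cs) (_ ∷ n)  rewrite ⊓-zeroʳ c | 0∸n≡0 c = z≤n ∷ fill-0-⊴ cs n

sum-replicate-0 : ∀ K → sum (replicate K 0) ≡ 0
sum-replicate-0 zero    = refl
sum-replicate-0 (suc K) = sum-replicate-0 K

sum-zipWith-∸ : ∀ {k} {d n : Vec ℕ k} → Pointwise _≤_ d n → sum (zipWith _∸_ n d) + sum d ≡ sum n
sum-zipWith-∸ [] = refl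
sum-zipWith-∸ {d = d₀ ∷ d} {n₀ ∷ n} (d₀≤n₀ ∷ d≤n) = begin
  (n₀ ∸ d₀ + sum (zipWith _∸_ n d)) + (d₀ + sum d)  ≡⟨ interchange (n₀ ∸ d₀) _ d₀ (sum d) ⟩
  (n₀ ∸ d₀ + d₀) + (sum (zipWith _∸_ n d) + sum d)  ≡⟨ cong₂ _+_ (m∸n+n≡m d₀≤n₀) (sum-zipWith-∸ d≤n) ⟩
  n₀ + sum n                                        ∎
  where open ≡-Reasoning

m<[m/n]*n+n : ∀ m n .{{_ : NonZero n}} → m < m / n * n + n
m<[m/n]*n+n m n = begin-strict
  m                  ≡⟨ m≡m%n+[m/n]*n m n ⟩
  m % n + m / n * n  <⟨ +-monoˡ-< (m / n * n) (m%n<n m n) ⟩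
  n + m / n * n      ≡⟨ +-comm n (m / n * n) ⟩
  m / n * n + n      ∎
  where open ≤-Reasoning

GridFill : ∀ {K} g → ℕ → Vec ℕ (suc K) → Set
GridFill {K} g s n = ∃ λ (e : Vec ℕ K) → sum e * g ≤ s + g × fill s (map (_* g) e) ⊴ n

module _ {K} g .{{_ : NonZero g}} {n : Vec ℕ (suc K)} where

  gridFill-0∷ : ∀ {s} → GridFill g s n → GridFill g s (0 ∷ n)
  gridFill-0∷ (e , e≤ , e⊴) = 0 ∷ e , e≤ , z≤n ∷ e⊴

  gridFill-∷ : ∀ {s} p → p / g * g < s → GridFill g (s ∸ p / g * g) n → GridFill g s (suc p ∷ n)
  gridFill-∷ {s} p q<s (e , e≤ , e⊴) = p / g ∷ e , bound , ≤-trans (m⊓n≤m q s) (m/n*n≤m p g) ∷ e⊴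
    where
    q = p / g * g
    bound : (p / g + sum e) * g ≤ s + g
    bound = begin
      (p / g + sum e) * g  ≡⟨ *-distribʳ-+ g (p / g) (sum e) ⟩
      q + sum e * g        ≤⟨ +-monoʳ-≤ q e≤ ⟩
      q + (s ∸ q + g)      ≡⟨ +-assoc q (s ∸ q) g ⟨
      q + (s ∸ q) + g      ≡⟨ cong (_+ g) (m+[n∸m]≡n (<⇒≤ q<s)) ⟩
      s + g                ∎
      where open ≤-Reasoning

  gridFill-saturate : ∀ {s} p → s ≤ p / g * g → GridFill g s (suc p ∷ n)
  gridFill-saturate {s} p s≤q = suc (s / g) ∷ replicate K 0 , bound , d≤p ∷ rest
    where
    c = suc (s / g) * g
    s≤c : s ≤ c
    s≤c = <⇒≤ (subst (s <_) (+-comm (s / g * g) g) (m<[m/n]*n+n s g))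
    d≤p : c ⊓ s ≤ p
    d≤p = ≤-trans (m⊓n≤n c s) (≤-trans s≤q (m/n*n≤m p g))
    rest : fill (s ∸ c) (map (_* g) (replicate K 0)) ⊴ n
    rest = subst (λ t → fill t (map (_* g) (replicate K 0)) ⊴ n) (sym (m≤n⇒m∸n≡0 s≤c)) (fill-0-⊴ _ n)
    bound : (suc (s / g) + sum (replicate K 0)) * g ≤ s + g
    bound = begin
      (suc (s / g) + sum (replicate K 0)) * g  ≡⟨ cong (λ m → (suc (s / g) + m) * g) (sum-replicate-0 K) ⟩
      (suc (s / g) + 0) * g                    ≡⟨ cong (_* g) (+-identityʳ (suc (s / g))) ⟩
      g + s / g * g                            ≤⟨ +-monoʳ-≤ g (m/n*n≤m s g) ⟩
      g + s                                    ≡⟨ +-comm g s ⟩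
      s + g                                    ∎
      where open ≤-Reasoning

gridFill : ∀ {K} g .{{_ : NonZero g}} s (n : Vec ℕ (suc K)) → s + K * g < sum n → GridFill g s n
gridFill {zero} g s (n ∷ []) s<n =
  [] , z≤n , pred-mono-≤ (subst₂ _<_ (+-identityʳ s) (+-identityʳ n) s<n) ∷ []
gridFill {suc K} g s (zero ∷ n) s<n =
  gridFill-0∷ g (gridFill g s n (≤-<-trans (+-monoʳ-≤ s (m≤n+m (K * g) g)) s<n))
gridFill {suc K} g s (suc p ∷ n) s<n with p / g * g <? s
... | no  q≮s = gridFill-saturate g p (≮⇒≥ q≮s)
... | yes q<s = gridFill-∷ g p q<s (gridFill g (s ∸ q) n (+-cancelˡ-< (q + g) _ _ budget))
  where
  q = p / g * g
  budget : (q + g) + (s ∸ q + K * g) < (q + g) + sum n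
  budget = begin-strict
    (q + g) + (s ∸ q + K * g)    ≡⟨ interchange q g (s ∸ q) (K * g) ⟩
    (q + (s ∸ q)) + (g + K * g)  ≡⟨ cong (_+ (g + K * g)) (m+[n∸m]≡n (<⇒≤ q<s)) ⟩
    s + (g + K * g)              <⟨ s<n ⟩
    suc p + sum n                ≤⟨ +-monoˡ-≤ (sum n) (m<[m/n]*n+n p g) ⟩
    (q + g) + sum n              ∎
    where open ≤-Reasoning

gridSpacing : ∀ K r h → suc r * K < h →
  ∃ λ g → NonZero g × K * g < h × (∀ (e : Vec ℕ K) → sum e * g ≤ r * h + g → sum e ≤ suc r * K)
gridSpacing zero r h rK<h = 1 , _ , ≤-trans (s≤s z≤n) rK<h , λ { [] _ → z≤n }
gridSpacing K@(suc _) r h@(suc h′) rK<h = g , >-nonZero g>0 , Kg<h , bound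
  where
  g = h′ / K
  g>0 : g > 0
  g>0 = m≥n⇒m/n>0 (≤-trans (m≤m+n K (r * K)) (s≤s⁻¹ rK<h))
  Kg<h : K * g < h
  Kg<h = s≤s (subst (_≤ h′) (*-comm g K) (m/n*n≤m h′ K))
  rh<rKg : r * h < suc r * K * g
  rh<rKg = +-cancelˡ-< h _ _ (begin-strict
    suc r * h                    ≤⟨ *-monoʳ-≤ (suc r) (m<[m/n]*n+n h′ K) ⟩
    suc r * (g * K + K)          ≡⟨ *-distribˡ-+ (suc r) (g * K) K ⟩
    suc r * (g * K) + suc r * K  <⟨ +-monoʳ-< (suc r * (g * K)) rK<h ⟩
    suc r * (g * K) + h          ≡⟨ +-comm (suc r * (g * K)) h ⟩
    h + suc r * (g * K)          ≡⟨ cong (λ m → h + suc r * m) (*-comm g K) ⟩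
    h + suc r * (K * g)          ≡⟨ cong (h +_) (*-assoc (suc r) K g) ⟨
    h + suc r * K * g            ∎)
    where open ≤-Reasoning
  bound : ∀ (e : Vec ℕ K) → sum e * g ≤ r * h + g → sum e ≤ suc r * K
  bound e le = s≤s⁻¹ (*-cancelʳ-< g (sum e) (suc (suc r * K)) (begin-strict
    sum e * g              ≤⟨ le ⟩
    r * h + g              <⟨ +-monoˡ-< g rh<rKg ⟩
    suc r * K * g + g      ≡⟨ +-comm (suc r * K * g) g ⟩
    suc (suc r * K) * g    ∎))
    where open ≤-Reasoning

incHead : ∀ {K} → Vec ℕ (suc K) → Vec ℕ (suc K)
incHead (x ∷ e) = suc x ∷ e

vecsOfSumAtMost : (K T : ℕ) → List (Vec ℕ K)
vecsOfSumAtMost zero    _       = [ [] ]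
vecsOfSumAtMost (suc K) zero    = List.map (0 ∷_) (vecsOfSumAtMost K 0)
vecsOfSumAtMost (suc K) (suc T) =
  List.map (0 ∷_) (vecsOfSumAtMost K (suc T)) ++ List.map incHead (vecsOfSumAtMost (suc K) T)

length-vecsOfSumAtMost : ∀ K T → length (vecsOfSumAtMost K T) ≡ (T + K) C K
length-vecsOfSumAtMost zero    T       = refl
length-vecsOfSumAtMost (suc K) zero    = begin
  length (List.map (0 ∷_) (vecsOfSumAtMost K 0)) ≡⟨ length-map (0 ∷_) (vecsOfSumAtMost K 0) ⟩
  length (vecsOfSumAtMost K 0)                     ≡⟨ length-vecsOfSumAtMost K 0 ⟩
  K C K                                            ≡⟨ trans (nCn≡1 K) (sym (nCn≡1 (suc K))) ⟩
  suc K C suc K                                    ∎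
  where open ≡-Reasoning
length-vecsOfSumAtMost (suc K) (suc T) = begin
  length (List.map (0 ∷_) zeroHead ++ List.map incHead posHead)
    ≡⟨ length-++ (List.map (0 ∷_) zeroHead) ⟩
  length (List.map (0 ∷_) zeroHead) + length (List.map incHead posHead)
    ≡⟨ cong₂ _+_ (length-map (0 ∷_) zeroHead) (length-map incHead posHead) ⟩
  length zeroHead + length posHead
    ≡⟨ cong₂ _+_ (length-vecsOfSumAtMost K (suc T)) (length-vecsOfSumAtMost (suc K) T) ⟩
  (suc T + K) C K + (T + suc K) C suc K
    ≡⟨ cong (λ m → (suc T + K) C K + m C suc K) (+-suc T K) ⟩
  suc (T + K) C K + suc (T + K) C suc K
    ≡⟨ nCk+nC[k+1]≡[n+1]C[k+1] (suc (T + K)) K ⟩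
  suc (suc (T + K)) C suc K
    ≡⟨ cong (λ m → suc m C suc K) (+-suc T K) ⟨
  (suc T + suc K) C suc K ∎
  where
  open ≡-Reasoning
  zeroHead = vecsOfSumAtMost K (suc T)
  posHead = vecsOfSumAtMost (suc K) T

∈-vecsOfSumAtMost : ∀ {K T} (e : Vec ℕ K) → sum e ≤ T → e ∈ vecsOfSumAtMost K T
∈-vecsOfSumAtMost []                       _        = here refl
∈-vecsOfSumAtMost {T = zero}  (zero ∷ e)   e≤T      = ∈-map⁺ (0 ∷_) (∈-vecsOfSumAtMost e e≤T)
∈-vecsOfSumAtMost {T = suc T} (zero ∷ e)   e≤T      = ∈-++⁺ˡ (∈-map⁺ (0 ∷_) (∈-vecsOfSumAtMost e e≤T))
∈-vecsOfSumAtMost {suc K} {suc T} (suc x ∷ e) (s≤s e≤T) =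
  ∈-++⁺ʳ (List.map (0 ∷_) (vecsOfSumAtMost K (suc T))) (∈-map⁺ incHead (∈-vecsOfSumAtMost (x ∷ e) e≤T))

offsetFamily : ∀ K r h → suc r * K < h →
  ∃ λ (D : List (Vec ℕ (suc K))) → length D ≡ ((suc r + 1) * K) C K ×
    (∀ n → sum n ≡ suc r * h → ∃ λ d → d ∈ D × sum d ≡ r * h × d ⊴ n)
offsetFamily K r h rK<h with g , g≢0 , Kg<h , bound ← gridSpacing K r h rK<h =
  List.map offsets (vecsOfSumAtMost K (suc r * K)) , count , cover
  where
  instance _ = g≢0
  offsets : Vec ℕ K → Vec ℕ (suc K)
  offsets e = fill (r * h) (map (_* g) e)
  count : length (List.map offsets (vecsOfSumAtMost K (suc r * K))) ≡ ((suc r + 1) * K) C K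
  count = begin
    length (List.map offsets (vecsOfSumAtMost K (suc r * K))) ≡⟨ length-map offsets (vecsOfSumAtMost K (suc r * K)) ⟩
    length (vecsOfSumAtMost K (suc r * K))                   ≡⟨ length-vecsOfSumAtMost K (suc r * K) ⟩
    (suc r * K + K) C K                                      ≡⟨ cong (_C K) (cong (suc r * K +_) (*-identityˡ K)) ⟨
    (suc r * K + 1 * K) C K                                  ≡⟨ cong (_C K) (*-distribʳ-+ K (suc r) 1) ⟨
    ((suc r + 1) * K) C K                                    ∎
    where open ≡-Reasoning
  budget : ∀ n → sum n ≡ suc r * h → r * h + K * g < sum n
  budget n sn = subst (r * h + K * g <_) (trans (+-comm (r * h) h) (sym sn)) (+-monoʳ-< (r * h) Kg<h)
  cover : ∀ n → sum n ≡ suc r * h → ∃ λ d → d ∈ List.map offsets (vecsOfSumAtMost K (suc r * K)) × sum d ≡ r * h × d ⊴ n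
  cover n sn with e , e≤ , e⊴ ← gridFill g (r * h) n (budget n sn) =
    offsets e , ∈-map⁺ offsets (∈-vecsOfSumAtMost e (bound e e≤)) , sum-fill (r * h) (map (_* g) e) , e⊴

module _ {c ℓ} (G : AbelianGroup c ℓ) where
  open AbelianGroup G renaming (refl to ≈-refl; sym to ≈-sym; trans to ≈-trans)
  open import Algebra.Properties.CommutativeSemigroup commutativeSemigroup using (x∙yz≈y∙xz)
    renaming (interchange to ∙-interchange)
  open import Algebra.Definitions.RawMonoid rawMonoid using () renaming (_×_ to _·_)
  open import Algebra.Properties.Monoid.Mult monoid using (×-homo-+)
  open import Algebra.Properties.CommutativeMonoid.Sum commutativeMonoid
    using (sum-syntax; sum-cong-≋; sum-cong-≗; ∑-distrib-+; sum-replicate-zero)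
  open import Relation.Binary.Reasoning.Setoid setoid

  •≡· : ∀ n x → _•_ G n x ≡ n · x
  •≡· zero    x = refl
  •≡· (suc n) x = cong (x ∙_) (•≡· n x)

  sumFin≡∑ : ∀ d (f : Fin d → Carrier) → sumFin G d f ≡ ∑[ i < d ] f i
  sumFin≡∑ zero    f = refl
  sumFin≡∑ (suc d) f = cong (f zero ∙_) (sumFin≡∑ d (λ i → f (suc i)))

  module _ {p} {A : Carrier → Set p} where

    foldSum-resp : ∀ N {x y} → x ≈ y → FoldSum G N A x → FoldSum G N A y
    foldSum-resp zero    x≈y (lift x≈ε)              = lift (≈-trans (≈-sym x≈y) x≈ε)
    foldSum-resp (suc N) x≈y (a , z , Aa , fz , x≈az) = a , z , Aa , fz , ≈-trans (≈-sym x≈y) x≈az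

    foldSum-+ : ∀ M {N y z} → FoldSum G M A y → FoldSum G N A z → FoldSum G (M + N) A (y ∙ z)
    foldSum-+ zero {N} {z = z} (lift y≈ε) fz =
      foldSum-resp N (≈-trans (≈-sym (identityˡ z)) (∙-congʳ (≈-sym y≈ε))) fz
    foldSum-+ (suc M) {z = z} (a , y , Aa , fy , x≈ay) fz =
      a , y ∙ z , Aa , foldSum-+ M fy fz , ≈-trans (∙-congʳ x≈ay) (assoc a y z)

    foldSum-* : ∀ r h {x} → FoldSum G r (FoldSum G h A) x → FoldSum G (r * h) A x
    foldSum-* zero    h (lift x≈ε)              = lift x≈ε
    foldSum-* (suc r) h (y , z , fy , fz , x≈yz) =
      foldSum-resp (h + r * h) (≈-sym x≈yz) (foldSum-+ h fy (foldSum-* r h fz))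

  foldSum-mono : ∀ {p q} {A : Carrier → Set p} {B : Carrier → Set q} →
    (∀ {x} → A x → B x) → ∀ N {x} → FoldSum G N A x → FoldSum G N B x
  foldSum-mono A⊆B zero    (lift x≈ε)              = lift x≈ε
  foldSum-mono A⊆B (suc N) (a , z , Aa , fz , x≈az) = a , z , A⊆B Aa , foldSum-mono A⊆B N fz , x≈az

  foldSum-⊎ : ∀ {p q r} {A : Carrier → Set p} {B : Carrier → Set q} {U : Carrier → Set r} →
    (∀ {x} → U x → A x ⊎ B x) → ∀ N {x} → FoldSum G N U x →
    ∃₂ λ M₁ M₂ → M₁ + M₂ ≡ N × SumSet G (FoldSum G M₁ A) (FoldSum G M₂ B) x
  foldSum-⊎ U⊆A∪B zero (lift x≈ε) =
    0 , 0 , refl , ε , ε , lift ≈-refl , lift ≈-refl , ≈-trans x≈ε (≈-sym (identityˡ ε))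
  foldSum-⊎ U⊆A∪B (suc N) {x} (c , z , Uc , fz , x≈cz)
    with M₁ , M₂ , M≡ , y , w , fy , fw , z≈yw ← foldSum-⊎ U⊆A∪B N fz
    with U⊆A∪B Uc
  ... | inj₁ Ac = suc M₁ , M₂ , cong suc M≡ , c ∙ y , w , (c , y , Ac , fy , ≈-refl) , fw , (begin
    x            ≈⟨ x≈cz ⟩
    c ∙ z        ≈⟨ ∙-congˡ z≈yw ⟩
    c ∙ (y ∙ w)  ≈⟨ assoc c y w ⟨
    c ∙ y ∙ w    ∎)
  ... | inj₂ Bc = M₁ , suc M₂ , trans (+-suc M₁ M₂) (cong suc M≡) , y , c ∙ w , fy , (c , w , Bc , fw , ≈-refl) ,
    ≈-trans x≈cz (≈-trans (∙-congˡ z≈yw) (x∙yz≈y∙xz c y w))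

  foldSum-⋃⁻ : ∀ {p k} (A : Fin k → Carrier → Set p) N {x} → FoldSum G N (λ y → ∃ λ i → A i y) x →
    ∃ λ (n : Vec ℕ k) → sum n ≡ N ×
      ∃ λ (w : Fin k → Carrier) → (∀ i → FoldSum G (lookup n i) (A i) (w i)) × x ≈ ∑[ i < k ] w i
  foldSum-⋃⁻ {k = zero}  A zero    (lift x≈ε)            = [] , refl , (λ ()) , (λ ()) , x≈ε
  foldSum-⋃⁻ {k = zero}  A (suc N) (_ , _ , (() , _) , _)
  foldSum-⋃⁻ {k = suc k} A N fx
    with M₁ , M₂ , M≡ , y , z , fy , fz , x≈yz ← foldSum-⊎ ∃-toSum N fx
    with n , n≡ , w , fw , z≈∑w ← foldSum-⋃⁻ (λ i → A (suc i)) M₂ fz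
    = M₁ ∷ n , trans (cong (M₁ +_) n≡) M≡ , (λ { zero → y ; (suc i) → w i }) , ∀-cons fy fw , ≈-trans x≈yz (∙-congˡ z≈∑w)

  foldSum-⋃⁺ : ∀ {p k} (A : Fin k → Carrier → Set p) (m : Vec ℕ k) (w : Fin k → Carrier) →
    (∀ i → FoldSum G (lookup m i) (A i) (w i)) → FoldSum G (sum m) (λ y → ∃ λ i → A i y) (∑[ i < k ] w i)
  foldSum-⋃⁺ A []       w fw = lift ≈-refl
  foldSum-⋃⁺ A (m ∷ ms) w fw = foldSum-+ m (foldSum-mono ∃-here m (fw zero))
    (foldSum-mono ∃-there (sum ms) (foldSum-⋃⁺ (λ i → A (suc i)) ms (λ i → w (suc i)) (λ i → fw (suc i))))

  module _ {p} {B : Carrier → Set p} {a : Carrier}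
           (B∙B⊆a∙B : ∀ {x y} → B x → B y → ∃ λ u → B u × x ∙ y ≈ a ∙ u) where

    foldSum-absorb : ∀ m {x y} → B x → FoldSum G (suc m) B y → ∃ λ u → FoldSum G (suc m) B u × x ∙ y ≈ a ∙ u
    foldSum-absorb m {x} {y} Bx (y₁ , y₂ , By₁ , fy₂ , y≈y₁y₂)
      with u , Bu , xy₁≈au ← B∙B⊆a∙B Bx By₁ = u ∙ y₂ , (u , y₂ , Bu , fy₂ , ≈-refl) , (begin
        x ∙ y           ≈⟨ ∙-congˡ y≈y₁y₂ ⟩
        x ∙ (y₁ ∙ y₂)   ≈⟨ assoc x y₁ y₂ ⟨
        (x ∙ y₁) ∙ y₂   ≈⟨ ∙-congʳ xy₁≈au ⟩
        (a ∙ u) ∙ y₂    ≈⟨ assoc a u y₂ ⟩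
        a ∙ (u ∙ y₂)    ∎)

    foldSum-peel : ∀ d m {w} → FoldSum G (d + suc m) B w → ∃ λ u → FoldSum G (suc m) B u × w ≈ d · a ∙ u
    foldSum-peel zero    m {w} fw = w , fw , ≈-sym (identityˡ w)
    foldSum-peel (suc d) m {w} (x , w₁ , Bx , fw₁ , w≈xw₁)
      with u₁ , fu₁ , w₁≈ ← foldSum-peel d m fw₁
      with u , fu , xu₁≈au ← foldSum-absorb m Bx fu₁ = u , fu , (begin
        w                  ≈⟨ w≈xw₁ ⟩
        x ∙ w₁             ≈⟨ ∙-congˡ w₁≈ ⟩
        x ∙ (d · a ∙ u₁)   ≈⟨ x∙yz≈y∙xz x (d · a) u₁ ⟩
        d · a ∙ (x ∙ u₁)   ≈⟨ ∙-congˡ xu₁≈au ⟩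
        d · a ∙ (a ∙ u)    ≈⟨ x∙yz≈y∙xz (d · a) a u ⟩
        a ∙ (d · a ∙ u)    ≈⟨ assoc a (d · a) u ⟨
        suc d · a ∙ u      ∎)

    foldSum-peel-pred : ∀ {d n w} → d ≤ pred n → FoldSum G n B w →
      ∃ λ u → FoldSum G (n ∸ d) B u × w ≈ d · a ∙ u
    foldSum-peel-pred {n = zero} z≤n fw = _ , fw , ≈-sym (identityˡ _)
    foldSum-peel-pred {d} {suc n} {w} d≤n fw rewrite +-∸-assoc 1 d≤n =
      foldSum-peel d (n ∸ d) (subst (λ N → FoldSum G N B w) (sym suc-n≡) fw)
      where
      suc-n≡ : d + suc (n ∸ d) ≡ suc n
      suc-n≡ = trans (+-suc d (n ∸ d)) (cong suc (m+[n∸m]≡n d≤n))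

  module _ (P : LinearSet G) where
    open LinearSet P

    periodSum : (Fin dim → ℕ) → Carrier
    periodSum cf = sumFin G dim (λ j → _•_ G (cf j) (periods j))

    periodSum≡∑ : ∀ cf → periodSum cf ≡ ∑[ j < dim ] (cf j · periods j)
    periodSum≡∑ cf = trans (sumFin≡∑ dim _) (sum-cong-≗ (λ j → •≡· (cf j) (periods j)))

    periodSum-+ : ∀ cf cf′ → periodSum (λ j → cf j + cf′ j) ≈ periodSum cf ∙ periodSum cf′
    periodSum-+ cf cf′ = begin
      periodSum (λ j → cf j + cf′ j)                         ≡⟨ periodSum≡∑ (λ j → cf j + cf′ j) ⟩
      ∑[ j < dim ] ((cf j + cf′ j) · periods j)              ≈⟨ sum-cong-≋ (λ j → ×-homo-+ (periods j) (cf j) (cf′ j)) ⟩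
      ∑[ j < dim ] (cf j · periods j ∙ cf′ j · periods j)    ≈⟨ ∑-distrib-+ (λ j → cf j · periods j) (λ j → cf′ j · periods j) ⟩
      ∑[ j < dim ] (cf j · periods j) ∙ ∑[ j < dim ] (cf′ j · periods j) ≡⟨ cong₂ _∙_ (periodSum≡∑ cf) (periodSum≡∑ cf′) ⟨
      periodSum cf ∙ periodSum cf′                           ∎

    base∈ : InLinear G P base
    base∈ = (λ _ → 0) , ≈-sym (≈-trans (∙-congˡ (≈-trans (reflexive (periodSum≡∑ (λ _ → 0))) (sum-replicate-zero dim)))
                                      (identityʳ base))

    InLinear-∙ : ∀ {x y} → InLinear G P x → InLinear G P y → ∃ λ u → InLinear G P u × x ∙ y ≈ base ∙ u
    InLinear-∙ {x} {y} (cf , x≈) (cf′ , y≈) = base ∙ periodSum (λ j → cf j + cf′ j) , ((λ j → cf j + cf′ j) , ≈-refl) , (begin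
      x ∙ y                                         ≈⟨ ∙-cong x≈ y≈ ⟩
      (base ∙ periodSum cf) ∙ (base ∙ periodSum cf′) ≈⟨ ∙-interchange base _ base _ ⟩
      (base ∙ base) ∙ (periodSum cf ∙ periodSum cf′) ≈⟨ assoc base base _ ⟩
      base ∙ (base ∙ (periodSum cf ∙ periodSum cf′)) ≈⟨ ∙-congˡ (∙-congˡ (periodSum-+ cf cf′)) ⟨
      base ∙ (base ∙ periodSum (λ j → cf j + cf′ j)) ∎)

  module _ {k} (L : Fin k → LinearSet G) where
    open LinearSet

    offset : Vec ℕ k → Carrier
    offset d = ∑[ i < k ] (lookup d i · base (L i))

    foldSum-peel-offset : ∀ N {x} → FoldSum G N (UnionOf G L) x → ∃ λ (n : Vec ℕ k) → sum n ≡ N ×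
      (∀ {d} → d ⊴ n → ∃ λ y → FoldSum G (N ∸ sum d) (UnionOf G L) y × x ≈ offset d ∙ y)
    foldSum-peel-offset N {x} fx with n , n≡ , w , fw , x≈∑w ← foldSum-⋃⁻ (λ i → InLinear G (L i)) N fx =
      n , n≡ , peel
      where
      peel : ∀ {d} → d ⊴ n → ∃ λ y → FoldSum G (N ∸ sum d) (UnionOf G L) y × x ≈ offset d ∙ y
      peel {d} d⊴n = ∑[ i < k ] u i , subst (λ M → FoldSum G M (UnionOf G L) (∑[ i < k ] u i)) count fu , (begin
        x                                                  ≈⟨ x≈∑w ⟩
        ∑[ i < k ] w i                                     ≈⟨ sum-cong-≋ (λ i → proj₂ (proj₂ (peeled i))) ⟩
        ∑[ i < k ] (lookup d i · base (L i) ∙ u i)         ≈⟨ ∑-distrib-+ (λ i → lookup d i · base (L i)) u ⟩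
        offset d ∙ ∑[ i < k ] u i                          ∎)
        where
        peeled : ∀ i → ∃ λ u → FoldSum G (lookup n i ∸ lookup d i) (InLinear G (L i)) u × w i ≈ lookup d i · base (L i) ∙ u
        peeled i = foldSum-peel-pred (InLinear-∙ (L i)) (Pointwise.lookup d⊴n i) (fw i)
        u : Fin k → Carrier
        u i = proj₁ (peeled i)
        count : sum (zipWith _∸_ n d) ≡ N ∸ sum d
        count = trans (sym (m+n∸n≡m _ (sum d)))
                      (cong (_∸ sum d) (trans (sum-zipWith-∸ (Pointwise.map (λ le → ≤-trans le pred[n]≤n) d⊴n)) n≡))
        fu : FoldSum G (sum (zipWith _∸_ n d)) (UnionOf G L) (∑[ i < k ] u i)
        fu = foldSum-⋃⁺ (λ i → InLinear G (L i)) (zipWith _∸_ n d) u λ i →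
          subst (λ M → FoldSum G M (InLinear G (L i)) (u i)) (sym (lookup-zipWith _∸_ i n d)) (proj₁ (proj₂ (peeled i)))

    offsets-cover : ∀ {r h} (D : List (Vec ℕ k)) →
      (∀ n → sum n ≡ suc r * h → ∃ λ d → d ∈ D × sum d ≡ r * h × d ⊴ n) →
      ∀ x → FoldSum G (suc r) (FoldSum G h (UnionOf G L)) x →
      SumSet G (ListSet G (List.map offset D)) (FoldSum G h (UnionOf G L)) x
    offsets-cover {r} {h} D cover x fx
      with n , n≡ , peel ← foldSum-peel-offset (suc r * h) (foldSum-* (suc r) h fx)
      with d , d∈D , d≡ , d⊴n ← cover n n≡
      with y , fy , x≈ ← peel d⊴n
      = offset d , y , lift (Any.map reflexive (∈-map⁺ offset d∈D)) ,
        subst (λ M → FoldSum G M (UnionOf G L) y) (trans (cong (suc r * h ∸_) d≡) (m+n∸n≡m h (r * h))) fy ,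
        x≈

theorem2p14 : ∀ {c ℓ : Level} (G : AbelianGroup c ℓ) (k : ℕ) → 1 ≤ k →
    (L : Fin k → LinearSet G) → (r : ℕ) → 1 ≤ r →
    IsAsymptoticApproxGroup G r (((r + 1) * (k ∸ 1)) C (k ∸ 1)) (UnionOf G L)
theorem2p14 G (suc K) _ L (suc r) _ =
  (LinearSet.base (L zero) , zero , base∈ G (L zero)) , suc (suc r * K) , s≤s z≤n , λ h rK<h →
    let D , |D| , cover = offsetFamily K r h rK<h in
    List.map (offset G L) D , ≤-reflexive (trans (length-map (offset G L) D) |D|) , offsets-cover G L D cover
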